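{- Assume that for every object $X$ the coequalizer $\rho_X\colon DX\to\tilde DX$ of $\iota_X^*,\ D\mathrm{fst}\colon D(X\times\mathbb{N})\to DX$ exists and is preserved by products. Then $\rho_X$ is also a coequalizer of the pair $$[\eta,[\eta\,\mathrm{fst},\iota(\mathrm{id}\times s)]]^*,\ [\eta,[\iota(\mathrm{id}\times s),\eta\,\mathrm{fst}]]^*\colon D(X+(X\times\mathbb{N}+X\times\mathbb{N}))\to DX.$$
   Context: $\mathbf{C}$ is an extensive category with finite products, a stable natural number object $(\mathbb{N},o,s)$ and exponentials $X^{\mathbb{N}}$. $DX$ is the final coalgebra of $X+(-)$ with invertible structure $\mathrm{out}$; $\mathbb{D}$ is the delay monad with unit $\eta=\mathrm{now}=\mathrm{out}^{ -1}\mathrm{inl}$ and Kleisli lifting of $f\colon X\to DY$ the unique $f^*$ with $\mathrm{out}\,f^*=[\mathrm{out}\,f,\mathrm{inr}\,f^*]\mathrm{out}$; $\mathrm{later}=\mathrm{out}^{ -1}\mathrm{inr}$. $\iota_X\colon X\times\mathbb{N}\to DX$ is defined by primitive recursion: $\iota(x,o)=\mathrm{now}(x)$, $\iota(x,s(n))=\mathrm{later}(\iota(x,n))$. Preservation by products means that for every object $Y$, $Y\times\rho_X$ is a coequalizer of $Y\times\iota^*_X$ and $Y\times D\mathrm{fst}$. -}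

module Defs where

open import Level using (Level; _⊔_) renaming (suc to lsuc)
open import Relation.Binary.PropositionalEquality using (_≡_)
open import Data.Product using (Σ; _,_) renaming (_×_ to _∧_)
open import Function.Bundles using (_⇔_)

record Category (o ℓ : Level) : Set (lsuc (o ⊔ ℓ)) where
  infixr 9 _∘_
  infix 4 _⇒_
  field
    Obj : Set o
    _⇒_ : Obj → Obj → Set ℓ
    id  : ∀ {A} → A ⇒ A
    _∘_ : ∀ {A B C} → B ⇒ C → A ⇒ B → A ⇒ C
    identityˡ : ∀ {A B} {f : A ⇒ B} → id ∘ f ≡ f
    identityʳ : ∀ {A B} {f : A ⇒ B} → f ∘ id ≡ f
    assoc : ∀ {A B C E} {f : A ⇒ B} {g : B ⇒ C} {h : C ⇒ E} →
            (h ∘ g) ∘ f ≡ h ∘ (g ∘ f)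

module Notions {o ℓ : Level} (𝒞 : Category o ℓ) where
  open Category 𝒞

  ∃! : {A : Set ℓ} → (A → Set ℓ) → Set ℓ
  ∃! {A} P = Σ A (λ u → P u ∧ (∀ v → P v → v ≡ u))

  IsCoequalizer : ∀ {A B Q} → A ⇒ B → A ⇒ B → B ⇒ Q → Set (o ⊔ ℓ)
  IsCoequalizer {B = B} f g q =
    (q ∘ f ≡ q ∘ g) ∧
    (∀ {Z} (h : B ⇒ Z) → h ∘ f ≡ h ∘ g → ∃! (λ u → u ∘ q ≡ h))

  IsPullback : ∀ {P X A C} → P ⇒ X → P ⇒ A → X ⇒ C → A ⇒ C → Set (o ⊔ ℓ)
  IsPullback {P} {X} {A} p₁ p₂ f g =
    (f ∘ p₁ ≡ g ∘ p₂) ∧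
    (∀ {Q} (q₁ : Q ⇒ X) (q₂ : Q ⇒ A) → f ∘ q₁ ≡ g ∘ q₂ →
       ∃! (λ (u : Q ⇒ P) → (p₁ ∘ u ≡ q₁) ∧ (p₂ ∘ u ≡ q₂)))

  IsCoproduct : ∀ {X₁ X₂ X} → X₁ ⇒ X → X₂ ⇒ X → Set (o ⊔ ℓ)
  IsCoproduct {X = X} i₁ i₂ =
    ∀ {Z} (h₁ : _ ⇒ Z) (h₂ : _ ⇒ Z) →
      ∃! (λ (u : X ⇒ Z) → (u ∘ i₁ ≡ h₁) ∧ (u ∘ i₂ ≡ h₂))

record Setting (a b : Level) : Set (lsuc (a ⊔ b)) where
  field
    cat : Category a b
  open Category cat public
  open Notions cat public
  infixr 7 _×_
  infixr 6 _+_
  infix 8 _^ℕ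
  field
    𝟙 : Obj
    ! : ∀ {A} → A ⇒ 𝟙
    !-unique : ∀ {A} (f : A ⇒ 𝟙) → f ≡ !
    _×_ : Obj → Obj → Obj
    fst : ∀ {A B} → A × B ⇒ A
    snd : ∀ {A B} → A × B ⇒ B
    ⟨_,_⟩ : ∀ {C A B} → C ⇒ A → C ⇒ B → C ⇒ A × B
    fst-β : ∀ {C A B} {f : C ⇒ A} {g : C ⇒ B} → fst ∘ ⟨ f , g ⟩ ≡ f
    snd-β : ∀ {C A B} {f : C ⇒ A} {g : C ⇒ B} → snd ∘ ⟨ f , g ⟩ ≡ g
    ×-unique : ∀ {C A B} {f : C ⇒ A} {g : C ⇒ B} {h : C ⇒ A × B} →
               fst ∘ h ≡ f → snd ∘ h ≡ g → h ≡ ⟨ f , g ⟩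
    𝟘 : Obj
    ¡ : ∀ {A} → 𝟘 ⇒ A
    ¡-unique : ∀ {A} (f : 𝟘 ⇒ A) → f ≡ ¡
    _+_ : Obj → Obj → Obj
    inl : ∀ {A B} → A ⇒ A + B
    inr : ∀ {A B} → B ⇒ A + B
    [_,_] : ∀ {A B C} → A ⇒ C → B ⇒ C → A + B ⇒ C
    inl-β : ∀ {A B C} {f : A ⇒ C} {g : B ⇒ C} → [ f , g ] ∘ inl ≡ f
    inr-β : ∀ {A B C} {f : A ⇒ C} {g : B ⇒ C} → [ f , g ] ∘ inr ≡ g
    +-unique : ∀ {A B C} {f : A ⇒ C} {g : B ⇒ C} {h : A + B ⇒ C} →
               h ∘ inl ≡ f → h ∘ inr ≡ g → h ≡ [ f , g ]

  _⁂_ : ∀ {A B C E} → A ⇒ B → C ⇒ E → A × C ⇒ B × E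
  f ⁂ g = ⟨ f ∘ fst , g ∘ snd ⟩

  _⊕_ : ∀ {A B C E} → A ⇒ B → C ⇒ E → A + C ⇒ B + E
  f ⊕ g = [ inl ∘ f , inr ∘ g ]

  field
    pb-inl : ∀ {X A B} (f : X ⇒ A + B) →
             Σ Obj (λ P → Σ (P ⇒ X) (λ p₁ → Σ (P ⇒ A) (λ p₂ →
               IsPullback p₁ p₂ f inl)))
    pb-inr : ∀ {X A B} (f : X ⇒ A + B) →
             Σ Obj (λ P → Σ (P ⇒ X) (λ p₁ → Σ (P ⇒ B) (λ p₂ →
               IsPullback p₁ p₂ f inr)))
    extensive : ∀ {X₁ X₂ X A B} (x₁ : X₁ ⇒ X) (x₂ : X₂ ⇒ X) (f : X ⇒ A + B)
                  (a₁ : X₁ ⇒ A) (a₂ : X₂ ⇒ B) →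
                  f ∘ x₁ ≡ inl ∘ a₁ → f ∘ x₂ ≡ inr ∘ a₂ →
                  IsCoproduct x₁ x₂ ⇔ (IsPullback x₁ a₁ f inl ∧ IsPullback x₂ a₂ f inr)

    ℕ : Obj
    o : 𝟙 ⇒ ℕ
    s : ℕ ⇒ ℕ
    rec : ∀ {Y X} → Y ⇒ X → X ⇒ X → Y × ℕ ⇒ X
    rec-o : ∀ {Y X} {f : Y ⇒ X} {g : X ⇒ X} → rec f g ∘ ⟨ id , o ∘ ! ⟩ ≡ f
    rec-s : ∀ {Y X} {f : Y ⇒ X} {g : X ⇒ X} → rec f g ∘ (id ⁂ s) ≡ g ∘ rec f g
    rec-unique : ∀ {Y X} {f : Y ⇒ X} {g : X ⇒ X} {h : Y × ℕ ⇒ X} →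
                 h ∘ ⟨ id , o ∘ ! ⟩ ≡ f → h ∘ (id ⁂ s) ≡ g ∘ h → h ≡ rec f g

    _^ℕ : Obj → Obj
    ev : ∀ {X} → (X ^ℕ) × ℕ ⇒ X
    curry : ∀ {Y X} → Y × ℕ ⇒ X → Y ⇒ X ^ℕ
    curry-β : ∀ {Y X} {f : Y × ℕ ⇒ X} → ev ∘ (curry f ⁂ id) ≡ f
    curry-unique : ∀ {Y X} {f : Y × ℕ ⇒ X} {g : Y ⇒ X ^ℕ} →
                   ev ∘ (g ⁂ id) ≡ f → g ≡ curry f

    D : Obj → Obj
    out : ∀ {X} → D X ⇒ X + D X
    unfold : ∀ {X Z} → Z ⇒ X + Z → Z ⇒ D X
    unfold-β : ∀ {X Z} {c : Z ⇒ X + Z} → out ∘ unfold c ≡ (id ⊕ unfold c) ∘ c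
    unfold-unique : ∀ {X Z} {c : Z ⇒ X + Z} {h : Z ⇒ D X} →
                    out ∘ h ≡ (id ⊕ h) ∘ c → h ≡ unfold c

  -- inverse of out (Lambek's lemma)
  out⁻¹ : ∀ {X} → X + D X ⇒ D X
  out⁻¹ = unfold (id ⊕ out)

  now : ∀ {X} → X ⇒ D X
  now = out⁻¹ ∘ inl

  η : ∀ {X} → X ⇒ D X
  η = now

  later : ∀ {X} → D X ⇒ D X
  later = out⁻¹ ∘ inr

  -- Kleisli lifting: f* is the unique map with out f* = [out f, inr f*] out,
  -- obtained by corecursion on DX + DY.
  _* : ∀ {X Y} → X ⇒ D Y → D X ⇒ D Y
  _* {X} {Y} f =
    unfold {Y} {D X + D Y}
      [ [ (id ⊕ inr) ∘ (out ∘ f) , inr ∘ inl ] ∘ out , (id ⊕ inr) ∘ out ]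
    ∘ inl

  Dmap : ∀ {X Y} → X ⇒ Y → D X ⇒ D Y
  Dmap f = unfold ((f ⊕ id) ∘ out)

  ι : ∀ {X} → X × ℕ ⇒ D X
  ι = rec now later

-- Both pairs of parallel maps are Kleisli liftings, and each is obtained from the
-- other by precomposition: writing f, g for the maps whose liftings are the new
-- pair, f = ι ψ₁ and g = ι ψ₂ with fst ψ₁ = fst ψ₂, while conversely ι = f j and
-- η fst = g j, where j sends (x, o) to x and (x, s n) to (x, n) in the last
-- summand. Since (k ψ)* = k* (η ψ)*, a map equalizes one pair iff it equalizes the
-- other, so the two pairs have the same coequalizers.
module Submission where

open import Level using (Level)
open import Data.Product using (_,_)
open import Relation.Binary.PropositionalEquality
  using (_≡_; refl; sym; trans; cong; cong₂; module ≡-Reasoning)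
open import Defs

module CoequalizerProperties {o ℓ : Level} (𝒞 : Category o ℓ) where
  open Category 𝒞
  open Notions 𝒞

  IsCoequalizer-transfer : ∀ {A A′ B Q} {a b : A ⇒ B} {c d : A′ ⇒ B} {q : B ⇒ Q} →
    (∀ {Z} (h : B ⇒ Z) → h ∘ a ≡ h ∘ b → h ∘ c ≡ h ∘ d) →
    (∀ {Z} (h : B ⇒ Z) → h ∘ c ≡ h ∘ d → h ∘ a ≡ h ∘ b) →
    IsCoequalizer a b q → IsCoequalizer c d q
  IsCoequalizer-transfer ab⇒cd cd⇒ab (q-coequalizes , q-universal) =
    ab⇒cd _ q-coequalizes , λ h e → q-universal h (cd⇒ab h e)

module DelayProperties {a b : Level} (S : Setting a b) where
  open Setting S
  open ≡-Reasoning

  pullˡ : ∀ {A B C E} {f : C ⇒ E} {g : B ⇒ C} {k : B ⇒ E} {h : A ⇒ B} →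
          f ∘ g ≡ k → f ∘ (g ∘ h) ≡ k ∘ h
  pullˡ {h = h} e = trans (sym assoc) (cong (_∘ h) e)

  pullʳ : ∀ {A B C E} {f : C ⇒ E} {g : B ⇒ C} {h : A ⇒ B} {k : A ⇒ C} →
          g ∘ h ≡ k → (f ∘ g) ∘ h ≡ f ∘ k
  pullʳ {f = f} e = trans assoc (cong (f ∘_) e)

  []-fusion : ∀ {A B C E} {h : C ⇒ E} {f : A ⇒ C} {g : B ⇒ C} →
              h ∘ [ f , g ] ≡ [ h ∘ f , h ∘ g ]
  []-fusion = +-unique (pullʳ inl-β) (pullʳ inr-β)

  ⊕-id : ∀ {A B} → id {A} ⊕ id {B} ≡ id
  ⊕-id = trans (cong₂ [_,_] identityʳ identityʳ) (sym (+-unique identityˡ identityˡ))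

  ⊕-∘ : ∀ {A B C E F G} {f : B ⇒ C} {g : E ⇒ F} {h : A ⇒ B} {k : G ⇒ E} →
        (f ⊕ g) ∘ (h ⊕ k) ≡ (f ∘ h) ⊕ (g ∘ k)
  ⊕-∘ = trans []-fusion (cong₂ [_,_]
          (trans (pullˡ inl-β) assoc) (trans (pullˡ inr-β) assoc))

  id⊕-∘ : ∀ {A B C E} {f : C ⇒ E} {g : B ⇒ C} →
          (id {A} ⊕ f) ∘ (id ⊕ g) ≡ id ⊕ (f ∘ g)
  id⊕-∘ = trans ⊕-∘ (cong (_⊕ _) identityˡ)

  id⊕-retract : ∀ {A B C} {r : C ⇒ B} {i : B ⇒ C} →
                r ∘ i ≡ id → (id {A} ⊕ r) ∘ (id ⊕ i) ≡ id
  id⊕-retract e = trans id⊕-∘ (trans (cong (id ⊕_) e) ⊕-id)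

  ⟨⟩-fusion : ∀ {A B C E} {f : C ⇒ A} {g : C ⇒ B} {h : E ⇒ C} →
              ⟨ f , g ⟩ ∘ h ≡ ⟨ f ∘ h , g ∘ h ⟩
  ⟨⟩-fusion = ×-unique (pullˡ fst-β) (pullˡ snd-β)

  fst-⁂ : ∀ {A B C} {f : B ⇒ C} → fst ∘ (id {A} ⁂ f) ≡ fst
  fst-⁂ = trans fst-β identityˡ

  unfold-reflect : ∀ {X} {h : D X ⇒ D X} → out ∘ h ≡ (id ⊕ h) ∘ out → h ≡ id
  unfold-reflect e = trans (unfold-unique e) (sym (unfold-unique
    (trans identityʳ (trans (sym identityˡ) (cong (_∘ out) (sym ⊕-id))))))

  out⁻¹∘out : ∀ {X} → out⁻¹ ∘ out ≡ id {D X}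
  out⁻¹∘out = unfold-reflect (begin
    out ∘ (out⁻¹ ∘ out)               ≡⟨ pullˡ unfold-β ⟩
    ((id ⊕ out⁻¹) ∘ (id ⊕ out)) ∘ out ≡⟨ cong (_∘ out) id⊕-∘ ⟩
    (id ⊕ (out⁻¹ ∘ out)) ∘ out        ∎)

  out∘out⁻¹ : ∀ {X} → out ∘ out⁻¹ ≡ id {X + D X}
  out∘out⁻¹ = trans unfold-β (id⊕-retract out⁻¹∘out)

  out-mono : ∀ {A X} {f g : A ⇒ D X} → out ∘ f ≡ out ∘ g → f ≡ g
  out-mono {f = f} {g} e = begin
    f                 ≡⟨ sym identityˡ ⟩
    id ∘ f            ≡⟨ cong (_∘ f) (sym out⁻¹∘out) ⟩
    (out⁻¹ ∘ out) ∘ f ≡⟨ pullʳ e ⟩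
    out⁻¹ ∘ (out ∘ g) ≡⟨ pullˡ out⁻¹∘out ⟩
    id ∘ g            ≡⟨ identityˡ ⟩
    g                 ∎

  out∘η : ∀ {X} → out ∘ η ≡ inl {X} {D X}
  out∘η = trans (pullˡ out∘out⁻¹) identityˡ

  module _ {X Y : Obj} (f : X ⇒ D Y) where
    private
      step : D X + D Y ⇒ Y + (D X + D Y)
      step = [ [ (id ⊕ inr) ∘ (out ∘ f) , inr ∘ inl ] ∘ out , (id ⊕ inr) ∘ out ]

      U : D X + D Y ⇒ D Y
      U = unfold step

      step-after : ∀ {H : D X + D Y ⇒ D Y} → H ∘ inr ≡ id →
                   (id ⊕ H) ∘ step ≡ [ [ out ∘ f , inr ∘ (H ∘ inl) ] ∘ out , out ]
      step-after {H} H∘inr = begin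
        (id ⊕ H) ∘ step
          ≡⟨ []-fusion ⟩
        [ (id ⊕ H) ∘ ([ (id ⊕ inr) ∘ (out ∘ f) , inr ∘ inl ] ∘ out)
        , (id ⊕ H) ∘ ((id ⊕ inr) ∘ out) ]
          ≡⟨ cong₂ [_,_] (pullˡ []-fusion) (trans (pullˡ (id⊕-retract H∘inr)) identityˡ) ⟩
        [ [ (id ⊕ H) ∘ ((id ⊕ inr) ∘ (out ∘ f)) , (id ⊕ H) ∘ (inr ∘ inl) ] ∘ out , out ]
          ≡⟨ cong (λ u → [ u ∘ out , out ]) (cong₂ [_,_]
               (trans (pullˡ (id⊕-retract H∘inr)) identityˡ) (trans (pullˡ inr-β) assoc)) ⟩
        [ [ out ∘ f , inr ∘ (H ∘ inl) ] ∘ out , out ] ∎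

      U∘inr : U ∘ inr ≡ id
      U∘inr = unfold-reflect (begin
        out ∘ (U ∘ inr)               ≡⟨ pullˡ unfold-β ⟩
        ((id ⊕ U) ∘ step) ∘ inr       ≡⟨ pullʳ inr-β ⟩
        (id ⊕ U) ∘ ((id ⊕ inr) ∘ out) ≡⟨ pullˡ id⊕-∘ ⟩
        (id ⊕ (U ∘ inr)) ∘ out        ∎)

    *-β : out ∘ (f *) ≡ [ out ∘ f , inr ∘ (f *) ] ∘ out
    *-β = begin
      out ∘ (U ∘ inl)          ≡⟨ pullˡ unfold-β ⟩
      ((id ⊕ U) ∘ step) ∘ inl  ≡⟨ cong (_∘ inl) (step-after U∘inr) ⟩
      [ [ out ∘ f , inr ∘ (U ∘ inl) ] ∘ out , out ] ∘ inl ≡⟨ inl-β ⟩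
      [ out ∘ f , inr ∘ (U ∘ inl) ] ∘ out ∎

    *-unique : ∀ {h : D X ⇒ D Y} → out ∘ h ≡ [ out ∘ f , inr ∘ h ] ∘ out → h ≡ f *
    *-unique {h} e = trans (sym inl-β) (cong (_∘ inl) (unfold-unique (begin
      out ∘ [ h , id ]
        ≡⟨ []-fusion ⟩
      [ out ∘ h , out ∘ id ]
        ≡⟨ cong₂ [_,_] (trans e (cong (λ u → [ out ∘ f , inr ∘ u ] ∘ out) (sym inl-β))) identityʳ ⟩
      [ [ out ∘ f , inr ∘ ([ h , id ] ∘ inl) ] ∘ out , out ]
        ≡⟨ sym (step-after inr-β) ⟩
      (id ⊕ [ h , id ]) ∘ step ∎)))

    *-∘η : (f *) ∘ η ≡ f
    *-∘η = out-mono (begin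
      out ∘ ((f *) ∘ η)                     ≡⟨ pullˡ *-β ⟩
      ([ out ∘ f , inr ∘ (f *) ] ∘ out) ∘ η ≡⟨ pullʳ out∘η ⟩
      [ out ∘ f , inr ∘ (f *) ] ∘ inl       ≡⟨ inl-β ⟩
      out ∘ f                               ∎)

  *-assoc : ∀ {X Y Z} (f : Y ⇒ D Z) (g : X ⇒ D Y) → ((f *) ∘ g) * ≡ (f *) ∘ (g *)
  *-assoc f g = sym (*-unique ((f *) ∘ g) (begin
    out ∘ ((f *) ∘ (g *))           ≡⟨ pullˡ (*-β f) ⟩
    (F ∘ out) ∘ (g *)               ≡⟨ pullʳ (*-β g) ⟩
    F ∘ ([ out ∘ g , inr ∘ (g *) ] ∘ out) ≡⟨ pullˡ []-fusion ⟩
    [ F ∘ (out ∘ g) , F ∘ (inr ∘ (g *)) ] ∘ out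
      ≡⟨ cong (_∘ out) (cong₂ [_,_]
           (trans (pullˡ (sym (*-β f))) assoc) (trans (pullˡ inr-β) assoc)) ⟩
    [ out ∘ ((f *) ∘ g) , inr ∘ ((f *) ∘ (g *)) ] ∘ out ∎))
    where
    F = [ out ∘ f , inr ∘ (f *) ]

  *-precomp : ∀ {W X Y} (k : X ⇒ D Y) (ψ : W ⇒ X) → (k ∘ ψ) * ≡ (k *) ∘ ((η ∘ ψ) *)
  *-precomp k ψ = begin
    (k ∘ ψ) *                ≡⟨ cong (λ u → (u ∘ ψ) *) (sym (*-∘η k)) ⟩
    (((k *) ∘ η) ∘ ψ) *      ≡⟨ cong _* assoc ⟩
    ((k *) ∘ (η ∘ ψ)) *      ≡⟨ *-assoc k (η ∘ ψ) ⟩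
    (k *) ∘ ((η ∘ ψ) *)      ∎

  equalizes*-precomp : ∀ {W X Y Q} {h : D Y ⇒ Q} {k l : X ⇒ D Y} (ψ : W ⇒ X) →
    h ∘ (k *) ≡ h ∘ (l *) → h ∘ ((k ∘ ψ) *) ≡ h ∘ ((l ∘ ψ) *)
  equalizes*-precomp {h = h} {k} {l} ψ e = begin
    h ∘ ((k ∘ ψ) *)             ≡⟨ cong (h ∘_) (*-precomp k ψ) ⟩
    h ∘ ((k *) ∘ ((η ∘ ψ) *))   ≡⟨ pullˡ e ⟩
    (h ∘ (l *)) ∘ ((η ∘ ψ) *)   ≡⟨ pullʳ (sym (*-precomp l ψ)) ⟩
    h ∘ ((l ∘ ψ) *)             ∎

  Dmap≡* : ∀ {X Y} (k : X ⇒ Y) → Dmap k ≡ (η ∘ k) *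
  Dmap≡* k = *-unique (η ∘ k) (begin
    out ∘ Dmap k                        ≡⟨ trans unfold-β (pullˡ ⊕-∘) ⟩
    ((id ∘ k) ⊕ (Dmap k ∘ id)) ∘ out    ≡⟨ cong (_∘ out) (cong₂ [_,_]
                                             (trans (cong (inl ∘_) identityˡ) (sym (pullˡ out∘η)))
                                             (cong (inr ∘_) identityʳ)) ⟩
    [ out ∘ (η ∘ k) , inr ∘ Dmap k ] ∘ out ∎)

  pair-o : ∀ {Y} → Y ⇒ Y × ℕ
  pair-o = ⟨ id , o ∘ ! ⟩

  -- The graph ⟨ h , id ⟩ is defined by a recursion that only involves h ∘ (id ⁂ s).
  ×ℕ-jointly-epic : ∀ {Y W} {h k : Y × ℕ ⇒ W} →
    h ∘ pair-o ≡ k ∘ pair-o → h ∘ (id ⁂ s) ≡ k ∘ (id ⁂ s) → h ≡ k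
  ×ℕ-jointly-epic {h = h} {k} e-o e-s = begin
    h               ≡⟨ sym fst-β ⟩
    fst ∘ ⟨ h , id ⟩ ≡⟨ cong (fst ∘_) (trans (graph-rec refl refl) (sym (graph-rec e-o e-s))) ⟩
    fst ∘ ⟨ k , id ⟩ ≡⟨ fst-β ⟩
    k               ∎
    where
    graph-rec : ∀ {l} → h ∘ pair-o ≡ l ∘ pair-o → h ∘ (id ⁂ s) ≡ l ∘ (id ⁂ s) →
      ⟨ l , id ⟩ ≡ rec ⟨ h ∘ pair-o , pair-o ⟩ ⟨ (h ∘ (id ⁂ s)) ∘ snd , (id ⁂ s) ∘ snd ⟩
    graph-rec {l} l-o l-s = rec-unique
      (trans ⟨⟩-fusion (cong₂ ⟨_,_⟩ (sym l-o) identityˡ))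
      (begin
        ⟨ l , id ⟩ ∘ (id ⁂ s)               ≡⟨ ⟨⟩-fusion ⟩
        ⟨ l ∘ (id ⁂ s) , id ∘ (id ⁂ s) ⟩     ≡⟨ cong₂ ⟨_,_⟩ (trans (sym l-s) (sym identityʳ))
                                                           (trans identityˡ (sym identityʳ)) ⟩
        ⟨ (h ∘ (id ⁂ s)) ∘ id , (id ⁂ s) ∘ id ⟩
          ≡⟨ cong₂ ⟨_,_⟩ (sym (pullʳ snd-β)) (sym (pullʳ snd-β)) ⟩
        ⟨ ((h ∘ (id ⁂ s)) ∘ snd) ∘ ⟨ l , id ⟩ , ((id ⁂ s) ∘ snd) ∘ ⟨ l , id ⟩ ⟩
          ≡⟨ sym ⟨⟩-fusion ⟩
        ⟨ (h ∘ (id ⁂ s)) ∘ snd , (id ⁂ s) ∘ snd ⟩ ∘ ⟨ l , id ⟩ ∎)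

  module _ {Y : Obj} where
    private
      pred-with-arg : Y × ℕ ⇒ (Y + Y × ℕ) × (Y × ℕ)
      pred-with-arg = rec ⟨ inl , pair-o ⟩ ⟨ inr ∘ snd , (id ⁂ s) ∘ snd ⟩

      snd-pred-with-arg : snd ∘ pred-with-arg ≡ id
      snd-pred-with-arg = trans
        (rec-unique (trans (pullʳ rec-o) snd-β) (trans (pullʳ rec-s) (trans (pullˡ snd-β) assoc)))
        (sym (rec-unique {h = id} identityˡ (trans identityˡ (sym identityʳ))))

    pred : Y × ℕ ⇒ Y + Y × ℕ
    pred = fst ∘ pred-with-arg

    pred-o : pred ∘ pair-o ≡ inl
    pred-o = trans (pullʳ rec-o) fst-β

    pred-s : pred ∘ (id ⁂ s) ≡ inr
    pred-s = begin
      (fst ∘ pred-with-arg) ∘ (id ⁂ s) ≡⟨ pullʳ rec-s ⟩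
      fst ∘ (⟨ inr ∘ snd , (id ⁂ s) ∘ snd ⟩ ∘ pred-with-arg) ≡⟨ pullˡ fst-β ⟩
      (inr ∘ snd) ∘ pred-with-arg ≡⟨ pullʳ snd-pred-with-arg ⟩
      inr ∘ id                    ≡⟨ identityʳ ⟩
      inr                         ∎

  cases-pred : ∀ {Y W} (h : Y × ℕ ⇒ W) → [ h ∘ pair-o , h ∘ (id ⁂ s) ] ∘ pred ≡ h
  cases-pred h = ×ℕ-jointly-epic (trans (pullʳ pred-o) inl-β) (trans (pullʳ pred-s) inr-β)

  module _ (X : Obj) where
    private
      f g : X + (X × ℕ + X × ℕ) ⇒ D X
      f = [ η , [ η ∘ fst , ι ∘ (id ⁂ s) ] ]
      g = [ η , [ ι ∘ (id ⁂ s) , η ∘ fst ] ]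

      ι∘pair-o : ι ∘ pair-o ≡ η {X}
      ι∘pair-o = rec-o

      ψ₁ ψ₂ : X + (X × ℕ + X × ℕ) ⇒ X × ℕ
      ψ₁ = [ pair-o , [ pair-o ∘ fst , id ⁂ s ] ]
      ψ₂ = [ pair-o , [ id ⁂ s , pair-o ∘ fst ] ]

      ι∘ψ₁ : ι ∘ ψ₁ ≡ f
      ι∘ψ₁ = trans []-fusion (cong₂ [_,_] ι∘pair-o
               (trans []-fusion (cong₂ [_,_] (pullˡ ι∘pair-o) refl)))

      ι∘ψ₂ : ι ∘ ψ₂ ≡ g
      ι∘ψ₂ = trans []-fusion (cong₂ [_,_] ι∘pair-o
               (trans []-fusion (cong₂ [_,_] refl (pullˡ ι∘pair-o))))

      fst∘ψ : ∀ {ψ : X × ℕ + X × ℕ ⇒ X × ℕ} → fst ∘ ψ ≡ [ fst , fst ] →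
              fst ∘ [ pair-o , ψ ] ≡ [ id , [ fst , fst ] ]
      fst∘ψ e = trans []-fusion (cong₂ [_,_] fst-β e)

      fst∘pair-o∘fst : fst ∘ (pair-o ∘ fst) ≡ fst {X} {ℕ}
      fst∘pair-o∘fst = trans (pullˡ fst-β) identityˡ

      fst∘ψ₁≡fst∘ψ₂ : fst ∘ ψ₁ ≡ fst ∘ ψ₂
      fst∘ψ₁≡fst∘ψ₂ = trans
        (fst∘ψ (trans []-fusion (cong₂ [_,_] fst∘pair-o∘fst fst-⁂)))
        (sym (fst∘ψ (trans []-fusion (cong₂ [_,_] fst-⁂ fst∘pair-o∘fst))))

      j : X × ℕ ⇒ X + (X × ℕ + X × ℕ)
      j = [ inl , inr ∘ inr ] ∘ pred

      through-j : ∀ {W} (k : X + (X × ℕ + X × ℕ) ⇒ W) →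
                  k ∘ j ≡ [ k ∘ inl , k ∘ (inr ∘ inr) ] ∘ pred
      through-j k = trans (sym assoc) (cong (_∘ pred) []-fusion)

      f∘j : f ∘ j ≡ ι
      f∘j = begin
        f ∘ j
          ≡⟨ through-j f ⟩
        [ f ∘ inl , f ∘ (inr ∘ inr) ] ∘ pred
          ≡⟨ cong (_∘ pred) (cong₂ [_,_] (trans inl-β (sym ι∘pair-o)) (trans (pullˡ inr-β) inr-β)) ⟩
        [ ι ∘ pair-o , ι ∘ (id ⁂ s) ] ∘ pred
          ≡⟨ cases-pred ι ⟩
        ι ∎

      g∘j : g ∘ j ≡ η ∘ fst
      g∘j = begin
        g ∘ j
          ≡⟨ through-j g ⟩
        [ g ∘ inl , g ∘ (inr ∘ inr) ] ∘ pred
          ≡⟨ cong (_∘ pred) (cong₂ [_,_] (trans inl-β (sym η∘fst∘pair-o))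
                                          (trans (pullˡ inr-β) (trans inr-β (sym (pullʳ fst-⁂))))) ⟩
        [ (η ∘ fst) ∘ pair-o , (η ∘ fst) ∘ (id ⁂ s) ] ∘ pred
          ≡⟨ cases-pred (η ∘ fst) ⟩
        η ∘ fst ∎
        where
        η∘fst∘pair-o : (η ∘ fst) ∘ pair-o ≡ η
        η∘fst∘pair-o = trans (pullʳ fst-β) identityʳ

    equalizes-ι⇒equalizes-fg : ∀ {Q} (h : D X ⇒ Q) →
      h ∘ (ι *) ≡ h ∘ Dmap fst → h ∘ (f *) ≡ h ∘ (g *)
    equalizes-ι⇒equalizes-fg h e = begin
      h ∘ (f *)                 ≡⟨ cong (λ u → h ∘ (u *)) (sym ι∘ψ₁) ⟩
      h ∘ ((ι ∘ ψ₁) *)          ≡⟨ equalizes*-precomp ψ₁ e′ ⟩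
      h ∘ (((η ∘ fst) ∘ ψ₁) *)  ≡⟨ cong (λ u → h ∘ (u *)) (pullʳ fst∘ψ₁≡fst∘ψ₂) ⟩
      h ∘ ((η ∘ (fst ∘ ψ₂)) *)  ≡⟨ cong (λ u → h ∘ (u *)) (sym assoc) ⟩
      h ∘ (((η ∘ fst) ∘ ψ₂) *)  ≡⟨ sym (equalizes*-precomp ψ₂ e′) ⟩
      h ∘ ((ι ∘ ψ₂) *)          ≡⟨ cong (λ u → h ∘ (u *)) ι∘ψ₂ ⟩
      h ∘ (g *)                 ∎
      where
      e′ : h ∘ (ι *) ≡ h ∘ ((η ∘ fst) *)
      e′ = trans e (cong (h ∘_) (Dmap≡* fst))

    equalizes-fg⇒equalizes-ι : ∀ {Q} (h : D X ⇒ Q) →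
      h ∘ (f *) ≡ h ∘ (g *) → h ∘ (ι *) ≡ h ∘ Dmap fst
    equalizes-fg⇒equalizes-ι h e = begin
      h ∘ (ι *)              ≡⟨ cong (λ u → h ∘ (u *)) (sym f∘j) ⟩
      h ∘ ((f ∘ j) *)        ≡⟨ equalizes*-precomp j e ⟩
      h ∘ ((g ∘ j) *)        ≡⟨ cong (λ u → h ∘ (u *)) g∘j ⟩
      h ∘ ((η ∘ fst) *)      ≡⟨ cong (h ∘_) (sym (Dmap≡* fst)) ⟩
      h ∘ Dmap fst           ∎

proposition6p5 : ∀ {ℓo ℓh : Level} (S : Setting ℓo ℓh) → let open Setting S in
    (D̃ : Obj → Obj) (ρ : ∀ X → D X ⇒ D̃ X) →
    (∀ X → IsCoequalizer (ι {X} *) (Dmap (fst {X} {ℕ})) (ρ X)) →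
    (∀ X Y → IsCoequalizer (id {Y} ⁂ (ι {X} *)) (id {Y} ⁂ Dmap (fst {X} {ℕ})) (id {Y} ⁂ ρ X)) →
    ∀ X → IsCoequalizer
            ([ η , [ η ∘ fst , ι ∘ (id ⁂ s) ] ] *)
            ([ η , [ ι ∘ (id ⁂ s) , η ∘ fst ] ] *)
            (ρ X)
proposition6p5 S D̃ ρ ρ-coequalizer _ X =
  IsCoequalizer-transfer
    (equalizes-ι⇒equalizes-fg X) (equalizes-fg⇒equalizes-ι X) (ρ-coequalizer X)
  where
  open Setting S using (cat)
  open CoequalizerProperties cat
  open DelayProperties S
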